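{- If positive integers $n,k$ satisfy $2^{n+1-k}\ge k$, then the reconstruction number of $\mathbb{Z}_2^n$ (acting on itself by translation) is at least $k$.
   Context: For a subset $T\subseteq \mathbb{Z}_2^n$ and an integer $j\ge 0$, let $T^{(j)}$ be the set of $j$-element subsets of $T$. The $j$-deck of $T$ is the multiset $\{\{\{g+U: g\in \mathbb{Z}_2^n\} : U\in T^{(j)}\}\}$ of all $j$-element subsets of $T$, each up to translation. Two subsets are $m$-indistinguishable if their $j$-decks coincide for all $j\le m$. The reconstruction number of a subset $T$ is the smallest $m$ such that every subset $U\subseteq \mathbb{Z}_2^n$ that is $m$-indistinguishable from $T$ is a translate $g+T$; the reconstruction number of $\mathbb{Z}_2^n$ is the maximum of this over all subsets $T$. -}

module Defs where

open import Data.Bool using (Bool; true; false; _xor_; _∧_; if_then_else_)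
import Data.Bool.Properties as BoolP
open import Data.Nat using (ℕ; zero; suc; _≤_; _<_; _≡ᵇ_)
open import Data.Vec using (Vec; []; _∷_; zipWith)
open import Data.Vec.Properties using (≡-dec)
open import Data.List using (List; []; _∷_; [_]; _++_; map; length; filterᵇ)
open import Data.Bool.ListAction using (any; all)
open import Data.Product using (∃; _×_)
open import Relation.Binary.PropositionalEquality using (_≡_)
open import Relation.Nullary using (¬_; does)

Pt : ℕ → Set
Pt n = Vec Bool n

_⊕_ : ∀ {n} → Pt n → Pt n → Pt n
_⊕_ = zipWith _xor_

_≟ₚ_ : ∀ {n} (x y : Pt n) → Bool
x ≟ₚ y = does (≡-dec BoolP._≟_ x y)

allPts : (n : ℕ) → List (Pt n)
allPts zero = [ [] ]
allPts (suc n) = map (false ∷_) (allPts n) ++ map (true ∷_) (allPts n)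

-- Subsets of Z_2^n as characteristic functions (equality is pointwise).
Sub : ℕ → Set
Sub n = Pt n → Bool

-- Translate g + T = { g + t : t ∈ T }, i.e. x ∈ g+T iff g + x ∈ T (characteristic 2).
_+ₛ_ : ∀ {n} → Pt n → Sub n → Sub n
(g +ₛ T) x = T (g ⊕ x)

IsTranslate : ∀ {n} → Sub n → Sub n → Set
IsTranslate {n} U T = ∃ λ (g : Pt n) → ∀ (x : Pt n) → U x ≡ (g +ₛ T) x

sameᵇ : ∀ {n} → Sub n → Sub n → Bool
sameᵇ {n} A B = all (λ x → does (BoolP._≟_ (A x) (B x))) (allPts n)

translateᵇ : ∀ {n} → Sub n → Sub n → Bool
translateᵇ {n} U T = any (λ g → sameᵇ U (g +ₛ T)) (allPts n)

sublists : ∀ {A : Set} → List A → List (List A)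
sublists [] = [ [] ]
sublists (x ∷ xs) = sublists xs ++ map (x ∷_) (sublists xs)

toSub : ∀ {n} → List (Pt n) → Sub n
toSub W x = any (x ≟ₚ_) W

-- T^(j): the list of all j-element subsets of T (each exactly once).
jSubsets : ∀ {n} → ℕ → Sub n → List (Sub n)
jSubsets {n} j T = map toSub (filterᵇ (λ W → length W ≡ᵇ j) (sublists (filterᵇ T (allPts n))))

-- Multiplicity, in the j-deck of T, of the translation class {g + S : g}.
deckMult : ∀ {n} → ℕ → Sub n → Sub n → ℕ
deckMult j T S = length (filterᵇ (λ W → translateᵇ W S) (jSubsets j T))

-- j-decks of T and U coincide (as multisets of translation classes):
-- every translation class has the same multiplicity.
SameDeck : ∀ {n} → ℕ → Sub n → Sub n → Set
SameDeck {n} j T U = ∀ (S : Sub n) → deckMult j T S ≡ deckMult j U S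

Indist : ∀ {n} → ℕ → Sub n → Sub n → Set
Indist m T U = ∀ j → j ≤ m → SameDeck j T U

Reconstructs : ∀ {n} → ℕ → Sub n → Set
Reconstructs {n} m T = ∀ (U : Sub n) → Indist m T U → IsTranslate U T

-- Reconstruction number of T (the least m with Reconstructs m T) is ≥ k.
RecNumSubAtLeast : ∀ {n} → Sub n → ℕ → Set
RecNumSubAtLeast T k = ∀ m → m < k → ¬ Reconstructs m T

-- Reconstruction number of Z_2^n (max over T) is ≥ k.
RecNumAtLeast : ℕ → ℕ → Set
RecNumAtLeast n k = ∃ λ (T : Sub n) → RecNumSubAtLeast T k

-- Write n = d + m with k = m + 1 and points of Z₂ⁿ as pairs (z, y) ∈ Z₂ᵈ × Z₂ᵐ. On Z₂ᵐ take the m + 1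
-- linear forms L₀ = parity and L_{j+1} = j-th coordinate: any m of them are independent, but L₀ is the sum
-- of the others. Label Z₂ᵈ onto {0, …, m} by ℓ (possible as 2ᵈ ≥ m + 1) and put
--   T = {(z, y) : L_{ℓ z}(y) = 0},   U = {(z, y) : L_{ℓ z}(y) = [ℓ z = 0]}.
-- Double counting the pairs (W, g) with W ⊆ X, |W| = j and W = g + S gives
--   mult_j(X, [S]) · |Stab S| = [|S| = j] · #{g : g + S ⊆ X},
-- so T and U are m-indistinguishable once they contain equally many translates of each S with |S| ≤ m.
-- For fixed z the translates (z, y) + S, y ∈ Z₂ᵐ, meet the same at most m labels, so some label i₀ is
-- missed by all of them; shifting y by a vector a with L_i(a) = [i = 0] for all i ≠ i₀ then matches the
-- translates inside T with those inside U. Yet U is not a translate of T: that would give y with L_i(y) = [i = 0] for every i.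

module Submission where

open import Defs
open import Algebra.Bundles using (CommutativeRing)
open import Data.Bool using (Bool; true; false; T; T?; not; _∧_; _∨_; _xor_; if_then_else_)
open import Data.Bool.ListAction using (all)
import Data.Bool.Properties as BoolP
open import Data.Empty using (⊥-elim)
open import Data.Fin using (Fin; zero; suc; toℕ)
import Data.Fin.Properties as FinP
open import Data.List using (List; []; _∷_; _++_; map; length; filterᵇ)
open import Data.List.Properties using (length-map)
import Data.List.Membership.DecPropositional as DecMembership
open import Data.List.Membership.Propositional using (_∈_; _∉_; lose)
open import Data.List.Membership.Propositional.Properties
  using (∈-++⁺ˡ; ∈-++⁺ʳ; ∈-++⁻; ∈-map⁺; ∈-map⁻; ∈-filter⁺; ∈-filter⁻)
import Data.List.Membership.Setoid.Properties as SetoidMembership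
open import Data.List.Relation.Unary.All as All using ([]; _∷_)
open import Data.List.Relation.Unary.All.Properties using (all⁺; all⁻; All¬⇒¬Any)
open import Data.List.Relation.Unary.AllPairs using ([]; _∷_)
open import Data.List.Relation.Unary.Any as Any using (here; there)
open import Data.List.Relation.Unary.Any.Properties using (any⁺; any⁻)
open import Data.List.Relation.Unary.Unique.Propositional using (Unique)
import Data.List.Relation.Unary.Unique.Propositional.Properties as Unique
open import Data.Nat using (ℕ; zero; suc; _+_; _*_; _∸_; _^_; _≤_; _<_; _≡ᵇ_; z≤n; s≤s; _<?_; >-nonZero)
open import Data.Nat.DivMod using (_mod_; _%_; m<n⇒m%n≡m)
open import Data.Nat.Properties
open import Data.Product using (∃; _×_; _,_; proj₂)
open import Data.Sum using (inj₁; inj₂)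
open import Data.Unit using (tt)
open import Data.Vec using (Vec; []; _∷_)
import Data.Vec as Vec
import Data.Vec.Properties as VecP
open import Function using (_∘_; case_of_; _⇔_; mk⇔; Equivalence)
open import Relation.Binary.Definitions using (DecidableEquality)
open import Relation.Binary.PropositionalEquality
open import Relation.Nullary using (¬_; Dec; does; yes; no; contradiction)
open import Relation.Nullary.Decidable using (dec-true; dec-false; decidable-stable)
open import Relation.Nullary.Reflects using (T-reflects-elim; fromEquivalence)
open import Algebra.Properties.CommutativeSemigroup +-commutativeSemigroup
  using () renaming (interchange to +-interchange; x∙yz≈y∙xz to +-left-comm)
open import Algebra.Properties.CommutativeSemigroup
  (CommutativeRing.+-commutativeSemigroup BoolP.xor-∧-commutativeRing)
  using () renaming (interchange to xor-interchange)

private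
  variable
    A B : Set
    d m n : ℕ

𝟙 : Bool → ℕ
𝟙 true  = 1
𝟙 false = 0

𝟙-∧ : ∀ a b → 𝟙 (a ∧ b) ≡ 𝟙 a * 𝟙 b
𝟙-∧ true  b = sym (+-identityʳ (𝟙 b))
𝟙-∧ false b = refl

sumOver : (A → ℕ) → List A → ℕ
sumOver f []       = 0
sumOver f (x ∷ xs) = f x + sumOver f xs

count : (A → Bool) → List A → ℕ
count P = sumOver (𝟙 ∘ P)

sumOver-cong : ∀ {f g : A → ℕ} xs → (∀ {x} → x ∈ xs → f x ≡ g x) → sumOver f xs ≡ sumOver g xs
sumOver-cong []       eq = refl
sumOver-cong (x ∷ xs) eq = cong₂ _+_ (eq (here refl)) (sumOver-cong xs (eq ∘ there))

sumOver-zero : (xs : List A) → sumOver (λ _ → 0) xs ≡ 0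
sumOver-zero []       = refl
sumOver-zero (x ∷ xs) = sumOver-zero xs

sumOver-++ : ∀ (f : A → ℕ) xs ys → sumOver f (xs ++ ys) ≡ sumOver f xs + sumOver f ys
sumOver-++ f []       ys = refl
sumOver-++ f (x ∷ xs) ys = trans (cong (f x +_) (sumOver-++ f xs ys)) (sym (+-assoc (f x) _ _))

sumOver-map : ∀ (f : B → ℕ) (h : A → B) xs → sumOver f (map h xs) ≡ sumOver (f ∘ h) xs
sumOver-map f h []       = refl
sumOver-map f h (x ∷ xs) = cong (f (h x) +_) (sumOver-map f h xs)

sumOver-+ : ∀ (f g : A → ℕ) xs → sumOver (λ x → f x + g x) xs ≡ sumOver f xs + sumOver g xs
sumOver-+ f g []       = refl
sumOver-+ f g (x ∷ xs) =
  trans (cong (f x + g x +_) (sumOver-+ f g xs)) (+-interchange (f x) (g x) _ _)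

*-distribˡ-sumOver : ∀ c (f : A → ℕ) xs → c * sumOver f xs ≡ sumOver (λ x → c * f x) xs
*-distribˡ-sumOver c f []       = *-zeroʳ c
*-distribˡ-sumOver c f (x ∷ xs) = trans (*-distribˡ-+ c (f x) _) (cong (c * f x +_) (*-distribˡ-sumOver c f xs))

*-distribʳ-sumOver : ∀ c (f : A → ℕ) xs → sumOver f xs * c ≡ sumOver (λ x → f x * c) xs
*-distribʳ-sumOver c f []       = refl
*-distribʳ-sumOver c f (x ∷ xs) = trans (*-distribʳ-+ c (f x) _) (cong (f x * c +_) (*-distribʳ-sumOver c f xs))

sumOver-comm : ∀ (f : A → B → ℕ) xs ys →
               sumOver (λ x → sumOver (f x) ys) xs ≡ sumOver (λ y → sumOver (λ x → f x y) xs) ys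
sumOver-comm f []       ys = sym (sumOver-zero ys)
sumOver-comm f (x ∷ xs) ys =
  trans (cong (sumOver (f x) ys +_) (sumOver-comm f xs ys)) (sym (sumOver-+ (f x) _ ys))

length-filterᵇ : ∀ (P : A → Bool) xs → length (filterᵇ P xs) ≡ count P xs
length-filterᵇ P []       = refl
length-filterᵇ P (x ∷ xs) with P x
... | true  = cong suc (length-filterᵇ P xs)
... | false = length-filterᵇ P xs

count-filterᵇ : ∀ (P Q : A → Bool) xs → count P (filterᵇ Q xs) ≡ count (λ x → Q x ∧ P x) xs
count-filterᵇ P Q []       = refl
count-filterᵇ P Q (x ∷ xs) with Q x
... | true  = cong (𝟙 (P x) +_) (count-filterᵇ P Q xs)
... | false = count-filterᵇ P Q xs

count-∧ˡ : ∀ b (P : A → Bool) xs → count (λ x → b ∧ P x) xs ≡ 𝟙 b * count P xs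
count-∧ˡ b P xs = trans (sumOver-cong xs (λ {x} _ → 𝟙-∧ b (P x))) (sym (*-distribˡ-sumOver (𝟙 b) _ xs))

count-split : ∀ b (P : A → Bool) xs →
  count (λ x → does (false BoolP.≟ b) ∧ P x) xs + count (λ x → does (true BoolP.≟ b) ∧ P x) xs ≡ count P xs
count-split false P xs = trans (cong (count P xs +_) (sumOver-zero xs)) (+-identityʳ _)
count-split true  P xs = cong (_+ count P xs) (sumOver-zero xs)

count-∨-disjoint : ∀ (P Q : A → Bool) xs → (∀ {x} → T (P x) → ¬ T (Q x)) →
                   count (λ x → P x ∨ Q x) xs ≡ count P xs + count Q xs
count-∨-disjoint P Q []       disj = refl
count-∨-disjoint P Q (x ∷ xs) disj with P x in px | Q x in qx
... | true  | true  = ⊥-elim (disj (Equivalence.from BoolP.T-≡ px) (Equivalence.from BoolP.T-≡ qx))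
... | true  | false = cong suc (count-∨-disjoint P Q xs disj)
... | false | q     =
  trans (cong (𝟙 q +_) (count-∨-disjoint P Q xs disj)) (+-left-comm (𝟙 q) (count P xs) (count Q xs))

count-pos : ∀ (P : A → Bool) {xs x} → x ∈ xs → T (P x) → 1 ≤ count P xs
count-pos P {y ∷ xs} (here refl) px with P y
... | true = s≤s z≤n
count-pos P {y ∷ xs} (there x∈xs) px = ≤-trans (count-pos P x∈xs px) (m≤n+m _ (𝟙 (P y)))

module _ (_≟_ : DecidableEquality A) where

  count-≡-∉ : ∀ {w xs} → w ∉ xs → count (λ y → does (y ≟ w)) xs ≡ 0
  count-≡-∉ {w} {[]}     w∉xs = refl
  count-≡-∉ {w} {y ∷ xs} w∉xs
    rewrite dec-false (y ≟ w) (λ y≡w → w∉xs (here (sym y≡w))) = count-≡-∉ (w∉xs ∘ there)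

  count-≡-unique : ∀ {w xs} → Unique xs → w ∈ xs → count (λ y → does (y ≟ w)) xs ≡ 1
  count-≡-unique {w} (y∉ ∷ u) (here refl) rewrite dec-true (w ≟ w) refl = cong suc (count-≡-∉ (All¬⇒¬Any y∉))
  count-≡-unique {w} {y ∷ _} (y∉ ∷ u) (there w∈xs)
    rewrite dec-false (y ≟ w) (λ { refl → All¬⇒¬Any y∉ w∈xs }) = count-≡-unique u w∈xs

T⇔→≡ : ∀ {a b} → T a ⇔ T b → a ≡ b
T⇔→≡ a⇔b = T-reflects-elim (fromEquivalence (Equivalence.to a⇔b) (Equivalence.from a⇔b))

T-does⁻ : ∀ {P : Set} (p? : Dec P) → T (does p?) → P
T-does⁻ (yes p) _ = p

T-does⁺ : ∀ {P : Set} (p? : Dec P) → P → T (does p?)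
T-does⁺ (yes _) _ = tt
T-does⁺ (no ¬p) p = ¬p p

¬T⇒≡false : ∀ {a} → ¬ T a → a ≡ false
¬T⇒≡false {false} _  = refl
¬T⇒≡false {true}  ¬t = ⊥-elim (¬t tt)

xor≡false⇒≡ : ∀ {a b} → a xor b ≡ false → a ≡ b
xor≡false⇒≡ {false} {false} _ = refl
xor≡false⇒≡ {true}  {true}  _ = refl

T-not-∨ : ∀ a {b} → T (not a ∨ b) ⇔ (T a → T b)
T-not-∨ true  = mk⇔ (λ t _ → t) (λ f → f tt)
T-not-∨ false = mk⇔ (λ _ ()) (λ _ → tt)

∧-congˡ-T : ∀ {a a′} b → (T b → a ≡ a′) → a ∧ b ≡ a′ ∧ b
∧-congˡ-T false _  = trans (BoolP.∧-zeroʳ _) (sym (BoolP.∧-zeroʳ _))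
∧-congˡ-T true  eq = cong (_∧ true) (eq tt)

0ᵖ : Pt n
0ᵖ = Vec.replicate _ false

⊕-comm : (x y : Pt n) → x ⊕ y ≡ y ⊕ x
⊕-comm = VecP.zipWith-comm BoolP.xor-comm

⊕-assoc : (x y z : Pt n) → (x ⊕ y) ⊕ z ≡ x ⊕ (y ⊕ z)
⊕-assoc = VecP.zipWith-assoc BoolP.xor-assoc

⊕-identityˡ : (x : Pt n) → 0ᵖ ⊕ x ≡ x
⊕-identityˡ = VecP.zipWith-identityˡ BoolP.xor-identityˡ

⊕-self : (x : Pt n) → x ⊕ x ≡ 0ᵖ
⊕-self x = trans (cong (x ⊕_) (sym (VecP.map-id x))) (VecP.zipWith-inverseʳ BoolP.xor-same x)

⊕-cancelˡ : (g x : Pt n) → g ⊕ (g ⊕ x) ≡ x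
⊕-cancelˡ g x = trans (sym (⊕-assoc g g x)) (trans (cong (_⊕ x) (⊕-self g)) (⊕-identityˡ x))

_≡?_ : DecidableEquality (Pt n)
_≡?_ = VecP.≡-dec BoolP._≟_

≟ₚ-refl : (x : Pt n) → x ≟ₚ x ≡ true
≟ₚ-refl x = dec-true (x ≡? x) refl

≟ₚ-≢ : ∀ {x y : Pt n} → x ≢ y → x ≟ₚ y ≡ false
≟ₚ-≢ {x = x} {y} = dec-false (x ≡? y)

take-++ : ∀ (z : Vec A d) (y : Vec A m) → Vec.take d (z Vec.++ y) ≡ z
take-++ []      y = refl
take-++ (b ∷ z) y = cong (b ∷_) (take-++ z y)

drop-++ : ∀ (z : Vec A d) (y : Vec A m) → Vec.drop d (z Vec.++ y) ≡ y
drop-++ []      y = refl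
drop-++ (b ∷ z) y = drop-++ z y

take-⊕-++ : ∀ (z : Pt d) (y : Pt m) q → Vec.take d ((z Vec.++ y) ⊕ q) ≡ z ⊕ Vec.take d q
take-⊕-++ {d} z y q = trans (VecP.take-zipWith _xor_ (z Vec.++ y) q) (cong (_⊕ Vec.take d q) (take-++ z y))

drop-⊕-++ : ∀ (z : Pt d) (y : Pt m) q → Vec.drop d ((z Vec.++ y) ⊕ q) ≡ y ⊕ Vec.drop d q
drop-⊕-++ {d} z y q = trans (VecP.drop-zipWith _xor_ (z Vec.++ y) q) (cong (_⊕ Vec.drop d q) (drop-++ z y))

allPts-complete : ∀ n (x : Pt n) → x ∈ allPts n
allPts-complete zero    []        = here refl
allPts-complete (suc n) (false ∷ x) = ∈-++⁺ˡ (∈-map⁺ (false ∷_) (allPts-complete n x))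
allPts-complete (suc n) (true ∷ x)  = ∈-++⁺ʳ _ (∈-map⁺ (true ∷_) (allPts-complete n x))

allPts-unique : ∀ n → Unique (allPts n)
allPts-unique zero    = [] ∷ []
allPts-unique (suc n) = Unique.++⁺ (Unique.map⁺ VecP.∷-injectiveʳ (allPts-unique n))
                                   (Unique.map⁺ VecP.∷-injectiveʳ (allPts-unique n)) halves-disjoint
  where
  halves-disjoint : ∀ {v} → ¬ (v ∈ map (false ∷_) (allPts n) × v ∈ map (true ∷_) (allPts n))
  halves-disjoint (v∈₀ , v∈₁) with ∈-map⁻ (false ∷_) v∈₀ | ∈-map⁻ (true ∷_) v∈₁
  ... | _ , _ , refl | _ , _ , ()

sumOver-allPts-suc : ∀ n (f : Pt (suc n) → ℕ) →
  sumOver f (allPts (suc n)) ≡ sumOver (f ∘ (false ∷_)) (allPts n) + sumOver (f ∘ (true ∷_)) (allPts n)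
sumOver-allPts-suc n f =
  trans (sumOver-++ f (map (false ∷_) (allPts n)) _)
        (cong₂ _+_ (sumOver-map f (false ∷_) (allPts n)) (sumOver-map f (true ∷_) (allPts n)))

sumOver-translate : ∀ n (c : Pt n) (f : Pt n → ℕ) → sumOver f (allPts n) ≡ sumOver (f ∘ (c ⊕_)) (allPts n)
sumOver-translate zero    []          f = refl
sumOver-translate (suc n) (false ∷ c) f =
  trans (sumOver-allPts-suc n f)
        (trans (cong₂ _+_ (sumOver-translate n c _) (sumOver-translate n c _))
               (sym (sumOver-allPts-suc n _)))
sumOver-translate (suc n) (true ∷ c) f =
  trans (sumOver-allPts-suc n f)
        (trans (+-comm (sumOver (f ∘ (false ∷_)) (allPts n)) _)
               (trans (cong₂ _+_ (sumOver-translate n c _) (sumOver-translate n c _))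
                      (sym (sumOver-allPts-suc n _))))

sumOver-allPts-+ : ∀ d {m} (f : Pt (d + m) → ℕ) →
  sumOver f (allPts (d + m)) ≡ sumOver (λ z → sumOver (λ y → f (z Vec.++ y)) (allPts m)) (allPts d)
sumOver-allPts-+ zero    f = sym (+-identityʳ _)
sumOver-allPts-+ (suc d) f =
  trans (sumOver-allPts-suc _ f)
        (trans (cong₂ _+_ (sumOver-allPts-+ d _) (sumOver-allPts-+ d _))
               (sym (sumOver-allPts-suc d _)))

size : Sub n → ℕ
size {n} A = count A (allPts n)

size-cong : ∀ {A B : Sub n} → A ≗ B → size A ≡ size B
size-cong {n} A≗B = sumOver-cong (allPts n) (λ {x} _ → cong 𝟙 (A≗B x))

size-translate : ∀ (g : Pt n) A → size (g +ₛ A) ≡ size A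
size-translate {n} g A = sym (sumOver-translate n g (𝟙 ∘ A))

sameᵇ⇒≗ : ∀ (A B : Sub n) → T (sameᵇ A B) → A ≗ B
sameᵇ⇒≗ {n} A B t x = T-does⁻ (A x BoolP.≟ B x) (All.lookup (all⁺ _ (allPts n) t) (allPts-complete n x))

≗⇒sameᵇ : ∀ {A B : Sub n} → A ≗ B → T (sameᵇ A B)
≗⇒sameᵇ {n} {A} {B} A≗B = all⁻ _ (All.tabulate {xs = allPts n} (λ {x} _ → T-does⁺ (A x BoolP.≟ B x) (A≗B x)))

sameᵇ-congˡ : ∀ {A A′ B : Sub n} → A ≗ A′ → sameᵇ A B ≡ sameᵇ A′ B
sameᵇ-congˡ {A = A} {A′} {B} A≗A′ = T⇔→≡ (mk⇔
  (λ t → ≗⇒sameᵇ (λ x → trans (sym (A≗A′ x)) (sameᵇ⇒≗ A B t x)))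
  (λ t → ≗⇒sameᵇ (λ x → trans (A≗A′ x) (sameᵇ⇒≗ A′ B t x))))

_⊆ᵇ_ : Sub n → Sub n → Bool
_⊆ᵇ_ {n} A B = all (λ x → not (A x) ∨ B x) (allPts n)

_⊆_ : Sub n → Sub n → Set
A ⊆ B = ∀ {x} → T (A x) → T (B x)

⊆ᵇ⇒⊆ : ∀ (A B : Sub n) → T (A ⊆ᵇ B) → A ⊆ B
⊆ᵇ⇒⊆ {n} A B t {x} = Equivalence.to (T-not-∨ (A x)) (All.lookup (all⁺ _ (allPts n) t) (allPts-complete n x))

⊆⇒⊆ᵇ : ∀ (A B : Sub n) → A ⊆ B → T (A ⊆ᵇ B)
⊆⇒⊆ᵇ {n} A B A⊆B = all⁻ _ (All.tabulate {xs = allPts n} (λ {x} _ → Equivalence.from (T-not-∨ (A x)) A⊆B))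

⊆ᵇ-translate-cong : ∀ {S X Y : Sub n} g h → (∀ {q} → T (S q) → X (g ⊕ q) ≡ Y (h ⊕ q)) →
                     (g +ₛ S) ⊆ᵇ X ≡ (h +ₛ S) ⊆ᵇ Y
⊆ᵇ-translate-cong {S = S} {X} {Y} g h agree = T⇔→≡ (mk⇔
  (λ t → ⊆⇒⊆ᵇ (h +ₛ S) Y (λ {x} Sq → subst (T ∘ Y) (⊕-cancelˡ h x)
    (subst T (agree Sq) (⊆ᵇ⇒⊆ (g +ₛ S) X t (subst (T ∘ S) (sym (⊕-cancelˡ g (h ⊕ x))) Sq)))))
  (λ t → ⊆⇒⊆ᵇ (g +ₛ S) X (λ {x} Sq → subst (T ∘ X) (⊕-cancelˡ g x)
    (subst T (sym (agree Sq)) (⊆ᵇ⇒⊆ (h +ₛ S) Y t (subst (T ∘ S) (sym (⊕-cancelˡ h (g ⊕ x))) Sq))))))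

_∖_ : Sub n → Pt n → Sub n
(A ∖ x) y = if y ≟ₚ x then false else A y

∖-self : ∀ (A : Sub n) x → (A ∖ x) x ≡ false
∖-self A x = cong (if_then false else A x) (≟ₚ-refl x)

∖-other : ∀ (A : Sub n) {x y} → y ≢ x → (A ∖ x) y ≡ A y
∖-other A {y = y} y≢x = cong (if_then false else A y) (≟ₚ-≢ y≢x)

∖-≗ : ∀ {A B : Sub n} {x} → (∀ {y} → y ≢ x → A y ≡ B y) → B x ≡ false → A ∖ x ≗ B
∖-≗ {A = A} {B} {x} agree Bx y with y ≡? x
... | yes refl = sym Bx
... | no  y≢x  = agree y≢x

sameᵇ-split : ∀ x (A B : Sub n) → sameᵇ A B ≡ does (A x BoolP.≟ B x) ∧ sameᵇ (A ∖ x) (B ∖ x)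
sameᵇ-split x A B = T⇔→≡ (mk⇔ split unsplit)
  where
  split : T (sameᵇ A B) → T (does (A x BoolP.≟ B x) ∧ sameᵇ (A ∖ x) (B ∖ x))
  split t = Equivalence.from BoolP.T-∧
    ( T-does⁺ (A x BoolP.≟ B x) (sameᵇ⇒≗ A B t x)
    , ≗⇒sameᵇ (λ y → cong (if y ≟ₚ x then false else_) (sameᵇ⇒≗ A B t y)))
  unsplit : T (does (A x BoolP.≟ B x) ∧ sameᵇ (A ∖ x) (B ∖ x)) → T (sameᵇ A B)
  unsplit t with Equivalence.to BoolP.T-∧ t
  ... | at-x , off-x = ≗⇒sameᵇ agree
    where
    agree : A ≗ B
    agree y with y ≡? x
    ... | yes refl = T-does⁻ (A x BoolP.≟ B x) at-x
    ... | no  y≢x  = trans (sym (∖-other A y≢x)) (trans (sameᵇ⇒≗ (A ∖ x) (B ∖ x) off-x y) (∖-other B y≢x))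

toSub⁻ : ∀ (W : List (Pt n)) {x} → T (toSub W x) → x ∈ W
toSub⁻ W {x} t = Any.map (λ {w} → T-does⁻ (x ≡? w)) (any⁻ _ W t)

toSub⁺ : ∀ (W : List (Pt n)) {x} → x ∈ W → T (toSub W x)
toSub⁺ W {x} x∈W = any⁺ _ (Any.map (λ {w} → T-does⁺ (x ≡? w)) x∈W)

toSub-∉ : ∀ {W : List (Pt n)} {x} → x ∉ W → toSub W x ≡ false
toSub-∉ {W = W} x∉W = ¬T⇒≡false (x∉W ∘ toSub⁻ W)

toSub-∖ : ∀ {W : List (Pt n)} {x} → x ∉ W → toSub W ∖ x ≗ toSub W
toSub-∖ x∉W = ∖-≗ (λ _ → refl) (toSub-∉ x∉W)

toSub-∷-∖ : ∀ {W : List (Pt n)} {x} → x ∉ W → toSub (x ∷ W) ∖ x ≗ toSub W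
toSub-∷-∖ {W = W} x∉W = ∖-≗ (λ {y} y≢x → cong (_∨ toSub W y) (≟ₚ-≢ y≢x)) (toSub-∉ x∉W)

sameᵇ-toSub-∉ : ∀ {W : List (Pt n)} {x} (A : Sub n) → x ∉ W →
  sameᵇ (toSub W) A ≡ does (false BoolP.≟ A x) ∧ sameᵇ (toSub W) (A ∖ x)
sameᵇ-toSub-∉ {W = W} {x} A x∉W =
  trans (sameᵇ-split x (toSub W) A)
        (cong₂ (λ b s → does (b BoolP.≟ A x) ∧ s) (toSub-∉ x∉W) (sameᵇ-congˡ (toSub-∖ x∉W)))

sameᵇ-toSub-∷ : ∀ {W : List (Pt n)} {x} (A : Sub n) → x ∉ W →
  sameᵇ (toSub (x ∷ W)) A ≡ does (true BoolP.≟ A x) ∧ sameᵇ (toSub W) (A ∖ x)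
sameᵇ-toSub-∷ {W = W} {x} A x∉W =
  trans (sameᵇ-split x (toSub (x ∷ W)) A)
        (cong₂ (λ b s → does (b BoolP.≟ A x) ∧ s) (cong (_∨ toSub W x) (≟ₚ-refl x))
                                                   (sameᵇ-congˡ (toSub-∷-∖ x∉W)))

∖-⊆ᵇ-toSub : ∀ (A : Sub n) x xs → (A ∖ x) ⊆ᵇ toSub xs ≡ A ⊆ᵇ toSub (x ∷ xs)
∖-⊆ᵇ-toSub A x xs = T⇔→≡ (mk⇔
  (λ t → ⊆⇒⊆ᵇ A (toSub (x ∷ xs)) (grow (⊆ᵇ⇒⊆ (A ∖ x) (toSub xs) t)))
  (λ t → ⊆⇒⊆ᵇ (A ∖ x) (toSub xs) (shrink (⊆ᵇ⇒⊆ A (toSub (x ∷ xs)) t))))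
  where
  grow : (A ∖ x) ⊆ toSub xs → A ⊆ toSub (x ∷ xs)
  grow A∖x⊆xs {y} Ay = case y ≡? x of λ where
    (yes refl) → toSub⁺ (x ∷ xs) (here refl)
    (no  y≢x)  → toSub⁺ (x ∷ xs) (there (toSub⁻ xs {y} (A∖x⊆xs (subst T (sym (∖-other A y≢x)) Ay))))
  shrink : A ⊆ toSub (x ∷ xs) → (A ∖ x) ⊆ toSub xs
  shrink A⊆x∷xs {y} A∖x∋y = case y ≡? x of λ where
    (yes refl) → ⊥-elim (subst T (∖-self A x) A∖x∋y)
    (no  y≢x)  → case toSub⁻ (x ∷ xs) {y} (A⊆x∷xs (subst T (∖-other A y≢x) A∖x∋y)) of λ where
      (here y≡x)   → ⊥-elim (y≢x y≡x)
      (there y∈xs) → toSub⁺ xs y∈xs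

sublists-⊆ : ∀ (xs : List A) {W} → W ∈ sublists xs → ∀ {y} → y ∈ W → y ∈ xs
sublists-⊆ []       (here refl) ()
sublists-⊆ (x ∷ xs) W∈ y∈W with ∈-++⁻ (sublists xs) W∈
... | inj₁ W∈xs = there (sublists-⊆ xs W∈xs y∈W)
... | inj₂ W∈x∷ with ∈-map⁻ (x ∷_) W∈x∷
...   | W′ , W′∈ , refl with y∈W
...     | here refl  = here refl
...     | there y∈W′ = there (sublists-⊆ xs W′∈ y∈W′)

sublists-unique : ∀ {xs : List A} → Unique xs → ∀ {W} → W ∈ sublists xs → Unique W
sublists-unique {xs = []}     _          (here refl) = []
sublists-unique {xs = x ∷ xs} (x∉ ∷ u) W∈ with ∈-++⁻ (sublists xs) W∈
... | inj₁ W∈xs = sublists-unique u W∈xs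
... | inj₂ W∈x∷ with ∈-map⁻ (x ∷_) W∈x∷
...   | W′ , W′∈ , refl = All.tabulate (All.lookup x∉ ∘ sublists-⊆ xs W′∈) ∷ sublists-unique u W′∈

count-sublists-≗ : ∀ {L : List (Pt n)} → Unique L → ∀ (A : Sub n) →
  count (λ W → sameᵇ (toSub W) A) (sublists L) ≡ 𝟙 (A ⊆ᵇ toSub L)
count-sublists-≗ {L = []} [] A = trans (+-identityʳ _) (cong 𝟙 (T⇔→≡ (mk⇔ empty⇒ ⇒empty)))
  where
  empty⇒ : T (sameᵇ (toSub []) A) → T (A ⊆ᵇ toSub [])
  empty⇒ t = ⊆⇒⊆ᵇ A (toSub []) (λ {x} Ax → subst T (sym (sameᵇ⇒≗ (toSub []) A t x)) Ax)
  ⇒empty : T (A ⊆ᵇ toSub []) → T (sameᵇ (toSub []) A)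
  ⇒empty t = ≗⇒sameᵇ (λ x → sym (¬T⇒≡false (⊆ᵇ⇒⊆ A (toSub []) t {x})))
count-sublists-≗ {n} {L = x ∷ xs} (x∉xs ∷ u) A = begin
    count s (sublists xs ++ map (x ∷_) (sublists xs))
  ≡⟨ sumOver-++ (𝟙 ∘ s) (sublists xs) _ ⟩
    count s (sublists xs) + count s (map (x ∷_) (sublists xs))
  ≡⟨ cong (count s (sublists xs) +_) (sumOver-map (𝟙 ∘ s) (x ∷_) (sublists xs)) ⟩
    count s (sublists xs) + count (s ∘ (x ∷_)) (sublists xs)
  ≡⟨ cong₂ _+_ (sumOver-cong (sublists xs) (λ W∈ → cong 𝟙 (sameᵇ-toSub-∉ A (x∉ W∈))))
               (sumOver-cong (sublists xs) (λ W∈ → cong 𝟙 (sameᵇ-toSub-∷ A (x∉ W∈)))) ⟩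
    count (λ W → does (false BoolP.≟ A x) ∧ s′ W) (sublists xs)
      + count (λ W → does (true BoolP.≟ A x) ∧ s′ W) (sublists xs)
  ≡⟨ count-split (A x) s′ (sublists xs) ⟩
    count s′ (sublists xs)
  ≡⟨ count-sublists-≗ u (A ∖ x) ⟩
    𝟙 ((A ∖ x) ⊆ᵇ toSub xs)
  ≡⟨ cong 𝟙 (∖-⊆ᵇ-toSub A x xs) ⟩
    𝟙 (A ⊆ᵇ toSub (x ∷ xs))
  ∎
  where
  open ≡-Reasoning
  s s′ : List (Pt n) → Bool
  s  W = sameᵇ (toSub W) A
  s′ W = sameᵇ (toSub W) (A ∖ x)
  x∉ : ∀ {W} → W ∈ sublists xs → x ∉ W
  x∉ W∈ x∈W = All¬⇒¬Any x∉xs (sublists-⊆ xs W∈ x∈W)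

size-toSub : ∀ {W : List (Pt n)} → Unique W → size (toSub W) ≡ length W
size-toSub {n} {[]}    []        = sumOver-zero (allPts n)
size-toSub {n} {w ∷ W} (w∉ ∷ u) =
  trans (count-∨-disjoint (_≟ₚ w) (toSub W) (allPts n) (λ {x} → disjoint {x}))
        (cong₂ _+_ (count-≡-unique _≡?_ (allPts-unique n) (allPts-complete n w))
                   (size-toSub u))
  where
  disjoint : ∀ {x} → T (x ≟ₚ w) → ¬ T (toSub W x)
  disjoint {x} x≟w x∈W with T-does⁻ (x ≡? w) x≟w
  ... | refl = All¬⇒¬Any w∉ (toSub⁻ W {w} x∈W)

⊆ᵇ-toSub-filter : ∀ (A X : Sub n) → A ⊆ᵇ toSub (filterᵇ X (allPts n)) ≡ A ⊆ᵇ X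
⊆ᵇ-toSub-filter {n} A X = T⇔→≡ (mk⇔
  (λ t → ⊆⇒⊆ᵇ A X (λ {x} Ax →
    proj₂ (∈-filter⁻ (T? ∘ X) {xs = allPts n} (toSub⁻ L {x} (⊆ᵇ⇒⊆ A (toSub L) t Ax)))))
  (λ t → ⊆⇒⊆ᵇ A (toSub L) (λ {x} Ax → toSub⁺ L (∈-filter⁺ (T? ∘ X) (allPts-complete n x) (⊆ᵇ⇒⊆ A X t Ax)))))
  where
  L : List (Pt n)
  L = filterᵇ X (allPts n)

-- Decks and translates
count-jSubsets : ∀ j (X A : Sub n) →
  count (λ W → sameᵇ W A) (jSubsets j X) ≡ 𝟙 ((size A ≡ᵇ j) ∧ (A ⊆ᵇ X))
count-jSubsets {n} j X A = begin
    count (λ W → sameᵇ W A) (map toSub (filterᵇ (λ W → length W ≡ᵇ j) (sublists L)))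
  ≡⟨ sumOver-map (λ W → 𝟙 (sameᵇ W A)) toSub (filterᵇ (λ W → length W ≡ᵇ j) (sublists L)) ⟩
    count s (filterᵇ (λ W → length W ≡ᵇ j) (sublists L))
  ≡⟨ count-filterᵇ s _ (sublists L) ⟩
    count (λ W → (length W ≡ᵇ j) ∧ s W) (sublists L)
  ≡⟨ sumOver-cong (sublists L) (cong 𝟙 ∘ length≡size) ⟩
    count (λ W → (size A ≡ᵇ j) ∧ s W) (sublists L)
  ≡⟨ count-∧ˡ (size A ≡ᵇ j) s (sublists L) ⟩
    𝟙 (size A ≡ᵇ j) * count s (sublists L)
  ≡⟨ cong (𝟙 (size A ≡ᵇ j) *_) (count-sublists-≗ L-unique A) ⟩
    𝟙 (size A ≡ᵇ j) * 𝟙 (A ⊆ᵇ toSub L)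
  ≡⟨ cong (λ b → 𝟙 (size A ≡ᵇ j) * 𝟙 b) (⊆ᵇ-toSub-filter A X) ⟩
    𝟙 (size A ≡ᵇ j) * 𝟙 (A ⊆ᵇ X)
  ≡⟨ sym (𝟙-∧ (size A ≡ᵇ j) (A ⊆ᵇ X)) ⟩
    𝟙 ((size A ≡ᵇ j) ∧ (A ⊆ᵇ X))
  ∎
  where
  open ≡-Reasoning
  L : List (Pt n)
  L = filterᵇ X (allPts n)
  L-unique : Unique L
  L-unique = Unique.filter⁺ (T? ∘ X) (allPts-unique n)
  s : List (Pt n) → Bool
  s W = sameᵇ (toSub W) A
  length≡size : ∀ {W} → W ∈ sublists L → (length W ≡ᵇ j) ∧ s W ≡ (size A ≡ᵇ j) ∧ s W
  length≡size {W} W∈ = ∧-congˡ-T (s W) (λ t → cong (_≡ᵇ j)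
    (trans (sym (size-toSub (sublists-unique L-unique W∈))) (size-cong (sameᵇ⇒≗ (toSub W) A t))))

stab : Sub n → ℕ
stab {n} S = count (λ g → sameᵇ S (g +ₛ S)) (allPts n)

fit : Sub n → Sub n → ℕ
fit {n} X S = count (λ g → (g +ₛ S) ⊆ᵇ X) (allPts n)

stab-pos : ∀ (S : Sub n) → 1 ≤ stab S
stab-pos {n} S = count-pos (λ g → sameᵇ S (g +ₛ S)) (allPts-complete n 0ᵖ)
                           (≗⇒sameᵇ (λ x → cong S (sym (⊕-identityˡ x))))

sameᵇ-translates : ∀ {W S : Sub n} {g₀} → W ≗ g₀ +ₛ S → ∀ g → sameᵇ W (g +ₛ S) ≡ sameᵇ S ((g₀ ⊕ g) +ₛ S)
sameᵇ-translates {W = W} {S} {g₀} W≗g₀S g = T⇔→≡ (mk⇔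
  (λ t → ≗⇒sameᵇ (λ y → begin
      S y                       ≡⟨ cong S (sym (⊕-cancelˡ g₀ y)) ⟩
      S (g₀ ⊕ (g₀ ⊕ y))         ≡⟨ sym (W≗g₀S (g₀ ⊕ y)) ⟩
      W (g₀ ⊕ y)                ≡⟨ sameᵇ⇒≗ W (g +ₛ S) t (g₀ ⊕ y) ⟩
      S (g ⊕ (g₀ ⊕ y))          ≡⟨ cong S (sym (⊕-assoc g g₀ y)) ⟩
      S ((g ⊕ g₀) ⊕ y)          ≡⟨ cong (λ h → S (h ⊕ y)) (⊕-comm g g₀) ⟩
      S ((g₀ ⊕ g) ⊕ y)          ∎))
  (λ t → ≗⇒sameᵇ (λ x → begin
      W x                       ≡⟨ W≗g₀S x ⟩
      S (g₀ ⊕ x)                ≡⟨ sameᵇ⇒≗ S ((g₀ ⊕ g) +ₛ S) t (g₀ ⊕ x) ⟩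
      S ((g₀ ⊕ g) ⊕ (g₀ ⊕ x))   ≡⟨ cong (λ h → S (h ⊕ (g₀ ⊕ x))) (⊕-comm g₀ g) ⟩
      S ((g ⊕ g₀) ⊕ (g₀ ⊕ x))   ≡⟨ cong S (⊕-assoc g g₀ (g₀ ⊕ x)) ⟩
      S (g ⊕ (g₀ ⊕ (g₀ ⊕ x)))   ≡⟨ cong (λ h → S (g ⊕ h)) (⊕-cancelˡ g₀ x) ⟩
      S (g ⊕ x)                 ∎)))
  where open ≡-Reasoning

count-translates : ∀ (W S : Sub n) → 𝟙 (translateᵇ W S) * stab S ≡ count (λ g → sameᵇ W (g +ₛ S)) (allPts n)
count-translates {n} W S with translateᵇ W S in eq
... | false = sym (trans (sumOver-cong (allPts n) (λ g∈ → cong 𝟙 (¬T⇒≡false (subst T eq ∘ any⁺ _ ∘ lose g∈))))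
                         (sumOver-zero (allPts n)))
... | true with Any.satisfied (any⁻ (λ g → sameᵇ W (g +ₛ S)) (allPts n) (Equivalence.from BoolP.T-≡ eq))
...   | g₀ , t = begin
    1 * stab S                                            ≡⟨ *-identityˡ (stab S) ⟩
    stab S                                                ≡⟨ sumOver-translate n g₀ _ ⟩
    count (λ g → sameᵇ S ((g₀ ⊕ g) +ₛ S)) (allPts n)
      ≡⟨ sumOver-cong (allPts n) (λ {g} _ → cong 𝟙 (sym (sameᵇ-translates {W = W} {S} W≗g₀S g))) ⟩
    count (λ g → sameᵇ W (g +ₛ S)) (allPts n)              ∎
  where
  open ≡-Reasoning
  W≗g₀S : W ≗ g₀ +ₛ S
  W≗g₀S = sameᵇ⇒≗ W (g₀ +ₛ S) t

deckMult*stab : ∀ j (X S : Sub n) → deckMult j X S * stab S ≡ 𝟙 (size S ≡ᵇ j) * fit X S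
deckMult*stab {n} j X S = begin
    deckMult j X S * stab S
  ≡⟨ cong (_* stab S) (length-filterᵇ (λ W → translateᵇ W S) (jSubsets j X)) ⟩
    count (λ W → translateᵇ W S) (jSubsets j X) * stab S
  ≡⟨ *-distribʳ-sumOver (stab S) _ (jSubsets j X) ⟩
    sumOver (λ W → 𝟙 (translateᵇ W S) * stab S) (jSubsets j X)
  ≡⟨ sumOver-cong (jSubsets j X) (λ {W} _ → count-translates W S) ⟩
    sumOver (λ W → count (λ g → sameᵇ W (g +ₛ S)) (allPts n)) (jSubsets j X)
  ≡⟨ sumOver-comm (λ W g → 𝟙 (sameᵇ W (g +ₛ S))) (jSubsets j X) (allPts n) ⟩
    sumOver (λ g → count (λ W → sameᵇ W (g +ₛ S)) (jSubsets j X)) (allPts n)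
  ≡⟨ sumOver-cong (allPts n) (λ {g} _ → count-jSubsets j X (g +ₛ S)) ⟩
    sumOver (λ g → 𝟙 ((size (g +ₛ S) ≡ᵇ j) ∧ ((g +ₛ S) ⊆ᵇ X))) (allPts n)
  ≡⟨ sumOver-cong (allPts n) (λ {g} _ → trans (cong (λ k → 𝟙 ((k ≡ᵇ j) ∧ ((g +ₛ S) ⊆ᵇ X))) (size-translate g S))
                                              (𝟙-∧ (size S ≡ᵇ j) ((g +ₛ S) ⊆ᵇ X))) ⟩
    sumOver (λ g → 𝟙 (size S ≡ᵇ j) * 𝟙 ((g +ₛ S) ⊆ᵇ X)) (allPts n)
  ≡⟨ sym (*-distribˡ-sumOver (𝟙 (size S ≡ᵇ j)) _ (allPts n)) ⟩
    𝟙 (size S ≡ᵇ j) * fit X S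
  ∎
  where open ≡-Reasoning

fits⇒Indist : ∀ m (X Y : Sub n) → (∀ S → size S ≤ m → fit X S ≡ fit Y S) → Indist m X Y
fits⇒Indist m X Y same-fits j j≤m S =
  *-cancelʳ-≡ _ _ (stab S) {{>-nonZero (stab-pos S)}}
    (trans (deckMult*stab j X S) (trans weighted (sym (deckMult*stab j Y S))))
  where
  weighted : 𝟙 (size S ≡ᵇ j) * fit X S ≡ 𝟙 (size S ≡ᵇ j) * fit Y S
  weighted with size S ≡ᵇ j in eq
  ... | false = refl
  ... | true  = cong (1 *_) (same-fits S (subst (_≤ m) (sym (≡ᵇ⇒≡ _ _ (Equivalence.from BoolP.T-≡ eq))) j≤m))

-- Linear forms on Z₂ᵐ
parity : Pt m → Bool
parity []      = false
parity (b ∷ y) = b xor parity y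

parity-⊕ : (x y : Pt m) → parity (x ⊕ y) ≡ parity x xor parity y
parity-⊕ []      []      = refl
parity-⊕ (a ∷ x) (b ∷ y) =
  trans (cong ((a xor b) xor_) (parity-⊕ x y)) (xor-interchange a b (parity x) (parity y))

parity-0 : ∀ m → parity (0ᵖ {m}) ≡ false
parity-0 zero    = refl
parity-0 (suc m) = parity-0 m

form : Fin (suc m) → Pt m → Bool
form zero    y = parity y
form (suc j) y = Vec.lookup y j

isZero : Fin (suc m) → Bool
isZero zero    = true
isZero (suc _) = false

form-⊕ : ∀ (i : Fin (suc m)) x y → form i (x ⊕ y) ≡ form i x xor form i y
form-⊕ zero    x y = parity-⊕ x y
form-⊕ (suc j) x y = VecP.lookup-zipWith _xor_ j x y

form-0 : ∀ (i : Fin (suc m)) → form i 0ᵖ ≡ false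
form-0 {m} zero    = parity-0 m
form-0     (suc j) = VecP.lookup-replicate j false

no-solution : ∀ (y : Pt m) → ¬ (∀ i → form i y ≡ isZero i)
no-solution y solves = contradiction (trans (sym (solves zero)) (parity-coords y (solves ∘ suc))) λ ()
  where
  parity-coords : ∀ {m} (y : Pt m) → (∀ j → Vec.lookup y j ≡ false) → parity y ≡ false
  parity-coords []      _      = refl
  parity-coords (b ∷ y) zeroes rewrite zeroes zero = parity-coords y (zeroes ∘ suc)

basis : Fin m → Pt m
basis zero    = true ∷ 0ᵖ
basis (suc j) = false ∷ basis j

parity-basis : ∀ (j : Fin m) → parity (basis j) ≡ true
parity-basis {suc m} zero    = cong not (parity-0 m)
parity-basis         (suc j) = parity-basis j

lookup-basis : ∀ (j j′ : Fin m) → j′ ≢ j → Vec.lookup (basis j) j′ ≡ false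
lookup-basis zero    zero     j′≢j = contradiction refl j′≢j
lookup-basis zero    (suc j′) _    = VecP.lookup-replicate j′ false
lookup-basis (suc j) zero     _    = refl
lookup-basis (suc j) (suc j′) j′≢j = lookup-basis j j′ (j′≢j ∘ cong suc)

-- Any m of the m + 1 forms are independent, so a vector can take the values isZero on all forms but one.
flipper : Fin (suc m) → Pt m
flipper zero    = 0ᵖ
flipper (suc j) = basis j

form-flipper : ∀ (i i₀ : Fin (suc m)) → i ≢ i₀ → form i (flipper i₀) ≡ isZero i
form-flipper zero    zero     i≢i₀ = contradiction refl i≢i₀
form-flipper (suc j) zero     _    = VecP.lookup-replicate j false
form-flipper zero    (suc j₀) _    = parity-basis j₀
form-flipper (suc j) (suc j₀) i≢i₀ = lookup-basis j₀ j (i≢i₀ ∘ cong suc)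

value : Pt d → ℕ
value             []      = 0
value {d = suc d} (b ∷ z) = (if b then 2 ^ d else 0) + value z

value-surjective : ∀ d {k} → k < 2 ^ d → ∃ λ (z : Pt d) → value z ≡ k
value-surjective zero    {zero}  _ = [] , refl
value-surjective zero    {suc k} (s≤s ())
value-surjective (suc d) {k} k< with k <? 2 ^ d
... | yes k<half = let z , eq = value-surjective d k<half in false ∷ z , eq
... | no  k≮half =
  let z , eq = value-surjective d upper-half in true ∷ z , trans (cong (2 ^ d +_) eq) (m+[n∸m]≡n half≤k)
  where
  half≤k : 2 ^ d ≤ k
  half≤k = ≮⇒≥ k≮half
  upper-half : k ∸ 2 ^ d < 2 ^ d
  upper-half = subst (k ∸ 2 ^ d <_) (+-identityʳ (2 ^ d))
    (+-cancelˡ-< (2 ^ d) _ _ (subst (_< 2 ^ suc d) (sym (m+[n∸m]≡n half≤k)) k<))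

label : Pt d → Fin (suc m)
label {m = m} z = value z mod suc m

label-surjective : suc m ≤ 2 ^ d → ∀ (i : Fin (suc m)) → ∃ λ (z : Pt d) → label z ≡ i
label-surjective {m} {d} bound i with value-surjective d (≤-trans (FinP.toℕ<n i) bound)
... | z , eq = z , FinP.toℕ-injective (begin
    toℕ (value z mod suc m)   ≡⟨ FinP.toℕ-fromℕ< _ ⟩
    value z % suc m           ≡⟨ cong (_% suc m) eq ⟩
    toℕ i % suc m             ≡⟨ m<n⇒m%n≡m (FinP.toℕ<n i) ⟩
    toℕ i                     ∎)
  where open ≡-Reasoning

∃-∉ : ∀ (xs : List (Fin n)) → length xs < n → ∃ λ i → i ∉ xs
∃-∉ {n} xs short = decidable-stable (FinP.any? (_∉? xs)) no-room
  where
  open DecMembership (FinP._≟_ {n}) using (_∈?_; _∉?_)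
  no-room : ¬ ¬ ∃ λ i → i ∉ xs
  no-room none =
    let i , j , i<j , same-index = FinP.pigeonhole short (Any.index ∘ every)
    in  FinP.<⇒≢ i<j (SetoidMembership.index-injective (setoid (Fin n)) (every i) (every j) same-index)
    where
    every : ∀ i → i ∈ xs
    every i = decidable-stable (i ∈? xs) (λ i∉xs → none (i , i∉xs))

-- The two indistinguishable sets
module Construction (d m : ℕ) where

  ℓ : Pt (d + m) → Fin (suc m)
  ℓ x = label (Vec.take d x)

  𝒯 𝒰 : Sub (d + m)
  𝒯 x = not (form (ℓ x) (Vec.drop d x))
  𝒰 x = not (isZero (ℓ x) xor form (ℓ x) (Vec.drop d x))

  𝒰-shift : ∀ z y q {i₀} → label (z ⊕ Vec.take d q) ≢ i₀ →
            𝒰 ((z Vec.++ (flipper i₀ ⊕ y)) ⊕ q) ≡ 𝒯 ((z Vec.++ y) ⊕ q)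
  𝒰-shift z y q {i₀} i≢i₀
    rewrite take-⊕-++ z (flipper i₀ ⊕ y) q | drop-⊕-++ z (flipper i₀ ⊕ y) q
          | take-⊕-++ z y q | drop-⊕-++ z y q = cong not (begin
        c xor form i ((flipper i₀ ⊕ y) ⊕ v)
      ≡⟨ cong (λ u → c xor form i u) (⊕-assoc (flipper i₀) y v) ⟩
        c xor form i (flipper i₀ ⊕ (y ⊕ v))
      ≡⟨ cong (c xor_) (form-⊕ i (flipper i₀) (y ⊕ v)) ⟩
        c xor (form i (flipper i₀) xor form i (y ⊕ v))
      ≡⟨ cong (λ b → c xor (b xor form i (y ⊕ v))) (form-flipper i i₀ i≢i₀) ⟩
        c xor (c xor form i (y ⊕ v))
      ≡⟨ BoolP.xor-assoc c c _ ⟨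
        (c xor c) xor form i (y ⊕ v)
      ≡⟨ cong (_xor form i (y ⊕ v)) (BoolP.xor-same c) ⟩
        form i (y ⊕ v)
      ∎)
    where
    open ≡-Reasoning
    i = label (z ⊕ Vec.take d q)
    c = isZero i
    v = Vec.drop d q

  fit-𝒯≡fit-𝒰 : ∀ S → size S ≤ m → fit 𝒯 S ≡ fit 𝒰 S
  fit-𝒯≡fit-𝒰 S small =
    trans (sumOver-allPts-+ d _)
          (trans (sumOver-cong (allPts d) (λ {z} _ → same-block z)) (sym (sumOver-allPts-+ d _)))
    where
    label-at : Pt d → Pt (d + m) → Fin (suc m)
    label-at z q = label (z ⊕ Vec.take d q)
    labels : Pt d → List (Fin (suc m))
    labels z = map (label-at z) (filterᵇ S (allPts (d + m)))
    few-labels : ∀ z → length (labels z) < suc m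
    few-labels z = s≤s (subst (_≤ m) (sym (trans (length-map (label-at z) (filterᵇ S (allPts (d + m))))
                                                 (length-filterᵇ S (allPts (d + m))))) small)
    same-block : ∀ z → count (λ y → ((z Vec.++ y) +ₛ S) ⊆ᵇ 𝒯) (allPts m)
                     ≡ count (λ y → ((z Vec.++ y) +ₛ S) ⊆ᵇ 𝒰) (allPts m)
    same-block z with ∃-∉ (labels z) (few-labels z)
    ... | i₀ , i₀∉ = begin
        count (λ y → ((z Vec.++ y) +ₛ S) ⊆ᵇ 𝒯) (allPts m)
      ≡⟨ sumOver-cong (allPts m) (λ {y} _ → cong 𝟙 (fits-match y)) ⟩
        count (λ y → ((z Vec.++ (flipper i₀ ⊕ y)) +ₛ S) ⊆ᵇ 𝒰) (allPts m)
      ≡⟨ sym (sumOver-translate m (flipper i₀) _) ⟩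
        count (λ y → ((z Vec.++ y) +ₛ S) ⊆ᵇ 𝒰) (allPts m)
      ∎
      where
      open ≡-Reasoning
      unused : ∀ {q} → T (S q) → label-at z q ≢ i₀
      unused {q} Sq eq =
        i₀∉ (subst (_∈ labels z) eq (∈-map⁺ (label-at z) (∈-filter⁺ (T? ∘ S) (allPts-complete _ q) Sq)))
      fits-match : ∀ y → ((z Vec.++ y) +ₛ S) ⊆ᵇ 𝒯 ≡ ((z Vec.++ (flipper i₀ ⊕ y)) +ₛ S) ⊆ᵇ 𝒰
      fits-match y = ⊆ᵇ-translate-cong (z Vec.++ y) (z Vec.++ (flipper i₀ ⊕ y)) (λ {q} Sq → sym (𝒰-shift z y q (unused Sq)))

  𝒰-not-translate : suc m ≤ 2 ^ d → ¬ IsTranslate 𝒰 𝒯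
  𝒰-not-translate bound (g , 𝒰≗g+𝒯) = no-solution y (λ i →
    let z , label-z≡i = label-surjective bound i in subst (λ i → form i y ≡ isZero i) label-z≡i (solves-at z))
    where
    y = Vec.drop d g
    solves-at : ∀ z → form (label z) y ≡ isZero (label z)
    solves-at z = sym (xor≡false⇒≡ (BoolP.not-injective (begin
        not (isZero (label z) xor form (label z) y)
      ≡⟨ cong₂ (λ z′ y′ → not (isZero (label z′) xor form (label z′) y′)) (take-++ z y) (drop-++ z y) ⟨
        𝒰 (z Vec.++ y)
      ≡⟨ 𝒰≗g+𝒯 (z Vec.++ y) ⟩
        not (form (ℓ (g ⊕ (z Vec.++ y))) (Vec.drop d (g ⊕ (z Vec.++ y))))
      ≡⟨ cong (λ v → not (form (ℓ (g ⊕ (z Vec.++ y))) v)) y⊕y ⟩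
        not (form (ℓ (g ⊕ (z Vec.++ y))) 0ᵖ)
      ≡⟨ cong not (form-0 (ℓ (g ⊕ (z Vec.++ y)))) ⟩
        true
      ∎)))
      where
      open ≡-Reasoning
      y⊕y : Vec.drop d (g ⊕ (z Vec.++ y)) ≡ 0ᵖ
      y⊕y = trans (VecP.drop-zipWith _xor_ g (z Vec.++ y)) (trans (cong (y ⊕_) (drop-++ z y)) (⊕-self y))

  reconstruction-number≥ : suc m ≤ 2 ^ d → RecNumAtLeast (d + m) (suc m)
  reconstruction-number≥ bound = 𝒯 , λ m′ m′<k reconstructs →
    𝒰-not-translate bound (reconstructs 𝒰 (λ j j≤m′ →
      fits⇒Indist m 𝒯 𝒰 fit-𝒯≡fit-𝒰 j (≤-trans j≤m′ (≤-pred m′<k))))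

m≤n-of-bound : ∀ m n → suc m ≤ 2 ^ (n ∸ m) → m ≤ n
m≤n-of-bound zero    n       _        = z≤n
m≤n-of-bound (suc m) zero    (s≤s ())
m≤n-of-bound (suc m) (suc n) bound    = s≤s (m≤n-of-bound m n (≤-trans (n≤1+n _) bound))

corollary2p4 : ∀ (n k : ℕ) → 1 ≤ n → 1 ≤ k → k ≤ 2 ^ (n + 1 ∸ k) → RecNumAtLeast n k
corollary2p4 n (suc m) _ _ bound =
  subst (λ n′ → RecNumAtLeast n′ (suc m)) (m∸n+n≡m (m≤n-of-bound m n bound′))
        (Construction.reconstruction-number≥ (n ∸ m) m bound′)
  where
  bound′ : suc m ≤ 2 ^ (n ∸ m)
  bound′ = subst (λ t → suc m ≤ 2 ^ (t ∸ suc m)) (+-comm n 1) bound
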